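{- Let $\langle s_1,\dots,s_k\rangle$ and $\langle r_1,\dots,r_\ell\rangle$ be two different non-increasing sequences of natural numbers such that $2\le k\le \ell$, $\sum_{i=1}^{k} s_i = \sum_{i=1}^{\ell} r_i$, and $s_i \ge r_i$ for all $i\in\{1,\dots,k-1\}$. Then $\prod_{i=1}^{k}(s_i+1) < \prod_{i=1}^{\ell}(r_i+1)$.
   Context: Natural numbers are the positive integers $\{1,2,3,\dots\}$ (the paper writes $\mathbb{N}_0$ when $0$ is included). -}

module Defs where

open import Data.Nat using (ℕ; suc; _≥_; _+_; _*_)
open import Data.List using (List; map)
open import Data.Nat.ListAction using (product)
open import Data.List.Relation.Unary.Linked using (Linked)
open import Data.List.Relation.Unary.All using (All)

NonIncreasing : List ℕ → Set
NonIncreasing = Linked _≥_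

-- natural numbers are positive: every entry is ≥ 1
Positive : List ℕ → Set
Positive = All (λ x → x ≥ 1)

prodSucc : List ℕ → ℕ
prodSucc xs = product (map suc xs)

-- Fix m and weigh x ∈ ℕ by φ(x) = (1 + x) / cˣ with c = (2 + m) / (1 + m). Since
-- (2 + m)(1 + x) − (1 + m)(2 + x) = x − m, φ increases on [0, m] and decreases on
-- [m, ∞), and φ(u + v) ≤ φ(u) φ(v) because 1 + u + v ≤ (1 + u)(1 + v).
-- Take m = rₖ and D = Σ_{i<k} (sᵢ − rᵢ). As rᵢ ≥ m for i < k, φ(sᵢ) ≤ φ(rᵢ), so
-- ∏_{i<k} (1 + sᵢ) ≤ c^D ∏_{i<k} (1 + rᵢ). The entries rₖ, …, r_ℓ are at most m and
-- sum to sₖ + D, so splitting sₖ among them gives c^D (1 + sₖ) ≤ ∏_{j≥k} (1 + rⱼ),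
-- strictly unless D = 0 and ℓ = k, that is, unless s = r.
module Submission where

open import Defs
open import Data.Nat using (ℕ; suc; _≤_; _<_; _≥_)
open import Data.List using (List; length; lookup)
open import Data.Nat.ListAction using (sum)
open import Data.Fin using (fromℕ<)
open import Relation.Binary.PropositionalEquality using (_≡_; _≢_)

open import Data.Nat using (zero; _+_; _*_; _^_; z≤n; s≤s; NonZero)
open import Data.Nat.Properties
open import Data.Nat.Tactic.RingSolver using (solve-∀)
open import Algebra.Properties.CommutativeSemigroup *-commutativeSemigroup
  using (x∙yz≈y∙xz; xy∙z≈y∙xz)
open import Data.List using ([]; _∷_)
open import Data.List.Membership.Propositional using (_∈_)
open import Data.List.Relation.Unary.Any using (here; there)
open import Data.List.Relation.Unary.All as All using (All; []; _∷_)
import Data.List.Relation.Unary.Linked as Linked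
open import Data.List.Relation.Unary.Linked.Properties using (Linked⇒All)
open import Data.Product using (∃-syntax; _,_)
open import Data.Sum using (inj₁; inj₂)
open import Data.Empty using (⊥-elim)
open import Relation.Binary.PropositionalEquality
  using (refl; sym; trans; cong; cong₂; subst; subst₂)

open ≤-Reasoning

suc[m+n]+m*n≡suc-m*suc-n : ∀ m n → suc (m + n) + m * n ≡ suc m * suc n
suc[m+n]+m*n≡suc-m*suc-n = solve-∀

suc[m+n]≤suc-m*suc-n : ∀ m n → suc (m + n) ≤ suc m * suc n
suc[m+n]≤suc-m*suc-n m n = begin
  suc (m + n)         ≤⟨ m≤m+n _ (m * n) ⟩
  suc (m + n) + m * n ≡⟨ suc[m+n]+m*n≡suc-m*suc-n m n ⟩
  suc m * suc n       ∎

suc[m+n]<suc-m*suc-n : ∀ {m n} → 1 ≤ m → 1 ≤ n → suc (m + n) < suc m * suc n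
suc[m+n]<suc-m*suc-n {m} {n} 1≤m 1≤n = begin-strict
  suc (m + n)         <⟨ m<m+n _ (*-mono-≤ 1≤m 1≤n) ⟩
  suc (m + n) + m * n ≡⟨ suc[m+n]+m*n≡suc-m*suc-n m n ⟩
  suc m * suc n       ∎

suc-sum≤prodSucc : ∀ xs → suc (sum xs) ≤ prodSucc xs
suc-sum≤prodSucc []       = ≤-refl
suc-sum≤prodSucc (x ∷ xs) = begin
  suc (x + sum xs)        ≤⟨ suc[m+n]≤suc-m*suc-n x (sum xs) ⟩
  suc x * suc (sum xs)    ≤⟨ *-monoʳ-≤ (suc x) (suc-sum≤prodSucc xs) ⟩
  suc x * prodSucc xs     ∎

suc-sum<prodSucc : ∀ {x y xs} → Positive (x ∷ y ∷ xs) →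
                   suc (sum (x ∷ y ∷ xs)) < prodSucc (x ∷ y ∷ xs)
suc-sum<prodSucc {x} {y} {xs} (1≤x ∷ 1≤y ∷ _) = begin-strict
  suc (x + sum (y ∷ xs))     <⟨ suc[m+n]<suc-m*suc-n 1≤x (≤-trans 1≤y (m≤m+n y (sum xs))) ⟩
  suc x * suc (sum (y ∷ xs)) ≤⟨ *-monoʳ-≤ (suc x) (suc-sum≤prodSucc (y ∷ xs)) ⟩
  suc x * prodSucc (y ∷ xs)  ∎

-- The ratio bounds X / B ≤ Q / P and C Q A / (E P Y) < 1, multiplied.
*-cross-< : ∀ {P Q B X C E A Y} .{{_ : NonZero B}} →
            P * X ≤ Q * B → C * Q * A < E * P * Y → C * (X * A) < E * (B * Y)
*-cross-< {P} {Q} {B} {X} {C} {E} {A} {Y} PX≤QB CQA<EPY = *-cancelˡ-< P _ _ (begin-strict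
  P * (C * (X * A)) ≡⟨ shuffle₁ P C X A ⟩
  C * A * (P * X)   ≤⟨ *-monoʳ-≤ (C * A) PX≤QB ⟩
  C * A * (Q * B)   ≡⟨ shuffle₂ C A Q B ⟩
  B * (C * Q * A)   <⟨ *-monoʳ-< B CQA<EPY ⟩
  B * (E * P * Y)   ≡⟨ shuffle₂ E Y P B ⟨
  E * Y * (P * B)   ≡⟨ shuffle₁ P E B Y ⟨
  P * (E * (B * Y)) ∎)
  where
  shuffle₁ : ∀ p c x a → p * (c * (x * a)) ≡ c * a * (p * x)
  shuffle₁ = solve-∀
  shuffle₂ : ∀ c a q b → c * a * (q * b) ≡ b * (c * q * a)
  shuffle₂ = solve-∀

φ-step-identity : ∀ m x → suc (suc m) * suc x + m ≡ suc m * suc (suc x) + x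
φ-step-identity = solve-∀

φ[1+x]≤φ[x] : ∀ {m x} → m ≤ x → suc m * suc (suc x) ≤ suc (suc m) * suc x
φ[1+x]≤φ[x] {m} {x} m≤x = +-cancelʳ-≤ m _ _ (begin
  suc m * suc (suc x) + m ≤⟨ +-monoʳ-≤ _ m≤x ⟩
  suc m * suc (suc x) + x ≡⟨ φ-step-identity m x ⟨
  suc (suc m) * suc x + m ∎)

φ[x]<φ[1+x] : ∀ {m x} → x < m → suc (suc m) * suc x < suc m * suc (suc x)
φ[x]<φ[1+x] {m} {x} x<m = +-cancelʳ-< x _ _ (begin-strict
  suc (suc m) * suc x + x <⟨ +-monoʳ-< _ x<m ⟩
  suc (suc m) * suc x + m ≡⟨ φ-step-identity m x ⟩
  suc m * suc (suc x) + x ∎)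

φ[a+d]≤φ[a] : ∀ {m} a d → m ≤ a →
              suc m ^ d * suc (a + d) ≤ suc (suc m) ^ d * suc a
φ[a+d]≤φ[a] a zero    _   = *-monoʳ-≤ 1 (≤-reflexive (cong suc (+-identityʳ a)))
φ[a+d]≤φ[a] {m} a (suc d) m≤a = begin
  suc m * suc m ^ d * suc (a + suc d)         ≡⟨ cong (λ n → suc m * suc m ^ d * suc n) (+-suc a d) ⟩
  suc m * suc m ^ d * suc (suc a + d)         ≡⟨ *-assoc (suc m) (suc m ^ d) (suc (suc a + d)) ⟩
  suc m * (suc m ^ d * suc (suc a + d))       ≤⟨ *-monoʳ-≤ (suc m) (φ[a+d]≤φ[a] (suc a) d (m≤n⇒m≤1+n m≤a)) ⟩
  suc m * (suc (suc m) ^ d * suc (suc a))     ≡⟨ x∙yz≈y∙xz (suc m) (suc (suc m) ^ d) (suc (suc a)) ⟩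
  suc (suc m) ^ d * (suc m * suc (suc a))     ≤⟨ *-monoʳ-≤ (suc (suc m) ^ d) (φ[1+x]≤φ[x] m≤a) ⟩
  suc (suc m) ^ d * (suc (suc m) * suc a)     ≡⟨ x∙yz≈y∙xz (suc (suc m) ^ d) (suc (suc m)) (suc a) ⟩
  suc (suc m) * (suc (suc m) ^ d * suc a)     ≡⟨ *-assoc (suc (suc m)) (suc (suc m) ^ d) (suc a) ⟨
  suc (suc m) * suc (suc m) ^ d * suc a       ∎

mutual
  weighted-suc≤prodSucc : ∀ {m} xs y D → All (_≤ m) xs → y + D ≡ sum xs →
                          suc (suc m) ^ D * suc y ≤ suc m ^ D * prodSucc xs
  weighted-suc≤prodSucc xs y zero    _     eq = *-monoʳ-≤ 1 (begin
    suc y           ≡⟨ cong suc (trans (sym (+-identityʳ y)) eq) ⟩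
    suc (sum xs)    ≤⟨ suc-sum≤prodSucc xs ⟩
    prodSucc xs     ∎)
  weighted-suc≤prodSucc xs y (suc D) xs≤m eq = <⇒≤ (weighted-suc<prodSucc xs y D xs≤m eq)

  weighted-suc<prodSucc : ∀ {m} xs y D → All (_≤ m) xs → y + suc D ≡ sum xs →
                          suc (suc m) ^ suc D * suc y < suc m ^ suc D * prodSucc xs
  weighted-suc<prodSucc {m} xs y D xs≤m eq with <-≤-connex y m
  ... | inj₁ y<m = begin-strict
    suc (suc m) * suc (suc m) ^ D * suc y     ≡⟨ xy∙z≈y∙xz (suc (suc m)) (suc (suc m) ^ D) (suc y) ⟩
    suc (suc m) ^ D * (suc (suc m) * suc y)   <⟨ *-monoʳ-< (suc (suc m) ^ D) {{m^n≢0 (suc (suc m)) D}} (φ[x]<φ[1+x] y<m) ⟩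
    suc (suc m) ^ D * (suc m * suc (suc y))   ≡⟨ x∙yz≈y∙xz (suc (suc m) ^ D) (suc m) (suc (suc y)) ⟩
    suc m * (suc (suc m) ^ D * suc (suc y))   ≤⟨ *-monoʳ-≤ (suc m) (weighted-suc≤prodSucc xs (suc y) D xs≤m
                                                    (trans (sym (+-suc y D)) eq)) ⟩
    suc m * (suc m ^ D * prodSucc xs)         ≡⟨ *-assoc (suc m) (suc m ^ D) (prodSucc xs) ⟨
    suc m * suc m ^ D * prodSucc xs           ∎
  weighted-suc<prodSucc [] zero    D xs≤m () | inj₂ _
  weighted-suc<prodSucc [] (suc y) D xs≤m () | inj₂ _
  weighted-suc<prodSucc {m} (x ∷ xs) y D (x≤m ∷ xs≤m) eq | inj₂ m≤y
    with m≤n⇒∃[o]m+o≡n (≤-trans x≤m m≤y)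
  ... | t , refl = begin-strict
    suc (suc m) ^ suc D * suc (x + t)         ≤⟨ *-monoʳ-≤ (suc (suc m) ^ suc D) (suc[m+n]≤suc-m*suc-n x t) ⟩
    suc (suc m) ^ suc D * (suc x * suc t)     ≡⟨ x∙yz≈y∙xz (suc (suc m) ^ suc D) (suc x) (suc t) ⟩
    suc x * (suc (suc m) ^ suc D * suc t)     <⟨ *-monoʳ-< (suc x) (weighted-suc<prodSucc xs t D xs≤m
                                                    (+-cancelˡ-≡ x _ _ (trans (sym (+-assoc x t (suc D))) eq))) ⟩
    suc x * (suc m ^ suc D * prodSucc xs)     ≡⟨ x∙yz≈y∙xz (suc x) (suc m ^ suc D) (prodSucc xs) ⟩
    suc m ^ suc D * (suc x * prodSucc xs)     ∎

-- s ≽[ m ] r: sᵢ ≥ rᵢ for i < k = length s ≤ length r, and m = rₖ.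
infix 4 _≽[_]_
data _≽[_]_ : List ℕ → ℕ → List ℕ → Set where
  last : ∀ {y a r} → y ∷ [] ≽[ a ] a ∷ r
  _∷_  : ∀ {x a m s r} → a ≤ x → s ≽[ m ] r → x ∷ s ≽[ m ] a ∷ r

≽-pivot∈ : ∀ {s m r} → s ≽[ m ] r → m ∈ r
≽-pivot∈ last    = here refl
≽-pivot∈ (_ ∷ p) = there (≽-pivot∈ p)

nonIncreasing⇒≤head : ∀ {a r} → NonIncreasing (a ∷ r) → All (_≤ a) (a ∷ r)
nonIncreasing⇒≤head = Linked⇒All (λ i≥j j≥k → ≤-trans j≥k i≥j) ≤-refl

weighted-prodSucc<prodSucc : ∀ {s m r} D → s ≽[ m ] r → NonIncreasing r → Positive r →
                             sum s + D ≡ sum r → (D ≡ 0 → s ≢ r) →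
                             suc (suc m) ^ D * prodSucc s < suc m ^ D * prodSucc r
weighted-prodSucc<prodSucc (suc D) (last {y} {a} {xs}) r↓ _ eq _ =
  subst (λ n → suc (suc a) ^ suc D * n < suc a ^ suc D * prodSucc (a ∷ xs))
        (sym (*-identityʳ (suc y)))
        (weighted-suc<prodSucc (a ∷ xs) y D (nonIncreasing⇒≤head r↓)
          (trans (cong (_+ suc D) (sym (+-identityʳ y))) eq))
weighted-prodSucc<prodSucc zero (last {y} {a} {[]}) _ _ eq s≢r =
  ⊥-elim (s≢r refl (cong (_∷ []) (+-cancelʳ-≡ 0 y a (trans (sym (+-identityʳ (y + 0))) eq))))
weighted-prodSucc<prodSucc zero (last {y} {a} {b ∷ xs}) _ r⁺ eq _ = *-monoʳ-< 1 (begin-strict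
  suc y * 1                    ≡⟨ *-identityʳ (suc y) ⟩
  suc y                        ≡⟨ cong suc (trans (sym (trans (+-identityʳ (y + 0)) (+-identityʳ y))) eq) ⟩
  suc (sum (a ∷ b ∷ xs))       <⟨ suc-sum<prodSucc r⁺ ⟩
  prodSucc (a ∷ b ∷ xs)        ∎)
weighted-prodSucc<prodSucc {m = m} D (_∷_ {a = a} {s = s} {r = r} a≤x s≽r) r↓ r⁺ eq s≢r
  with m≤n⇒∃[o]m+o≡n a≤x
... | d , refl =
  *-cross-< {P = suc m ^ d} {Q = suc (suc m) ^ d} {B = suc a} {X = suc (a + d)}
            {C = suc (suc m) ^ D} {E = suc m ^ D} {A = prodSucc s} {Y = prodSucc r}
            (φ[a+d]≤φ[a] a d m≤a) rest<
  where
  m≤a : m ≤ a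
  m≤a = All.lookup (nonIncreasing⇒≤head r↓) (there (≽-pivot∈ s≽r))
  shuffle : ∀ a d σ D → a + (σ + (D + d)) ≡ a + d + σ + D
  shuffle = solve-∀
  eq′ : sum s + (D + d) ≡ sum r
  eq′ = +-cancelˡ-≡ a _ _ (trans (shuffle a d (sum s) D) eq)
  s≢r′ : D + d ≡ 0 → s ≢ r
  s≢r′ D+d≡0 s≡r = s≢r (m+n≡0⇒m≡0 D D+d≡0)
    (cong₂ _∷_ (trans (cong (a +_) (m+n≡0⇒n≡0 D D+d≡0)) (+-identityʳ a)) s≡r)
  rest< : suc (suc m) ^ D * suc (suc m) ^ d * prodSucc s < suc m ^ D * suc m ^ d * prodSucc r
  rest< = subst₂ _<_
    (cong (_* prodSucc s) (^-distribˡ-+-* (suc (suc m)) D d))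
    (cong (_* prodSucc r) (^-distribˡ-+-* (suc m) D d))
    (weighted-prodSucc<prodSucc (D + d) s≽r (Linked.tail r↓) (All.tail r⁺) eq′ s≢r′)

lookup-dominance⇒≽ : ∀ s r → 1 ≤ length s → length s ≤ length r →
                     ((i : ℕ) → suc i < length s → (qs : i < length s) → (qr : i < length r) →
                       lookup s (fromℕ< qs) ≥ lookup r (fromℕ< qr)) →
                     ∃[ m ] s ≽[ m ] r
lookup-dominance⇒≽ (y ∷ [])     (a ∷ r) _ _           _   = a , last
lookup-dominance⇒≽ (x ∷ y ∷ s) (a ∷ r) _ (s≤s ls≤lr) dom
  with lookup-dominance⇒≽ (y ∷ s) r (s≤s z≤n) ls≤lr
         (λ i i<k qs qr → dom (suc i) (s≤s i<k) (s≤s qs) (s≤s qr))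
... | m , s≽r = m , dom 0 (s≤s (s≤s z≤n)) (s≤s z≤n) (s≤s z≤n) ∷ s≽r

lemma4 : (k ℓ : ℕ) → (s r : List ℕ) → length s ≡ k → length r ≡ ℓ →
    Positive s → Positive r → NonIncreasing s → NonIncreasing r →
    s ≢ r → 2 ≤ k → k ≤ ℓ → sum s ≡ sum r →
    ((i : ℕ) → (pi : suc i < k) → (qs : i < length s) → (qr : i < length r) →
    lookup s (fromℕ< qs) ≥ lookup r (fromℕ< qr)) →
    prodSucc s < prodSucc r
lemma4 .(length s) .(length r) s r refl refl _ r⁺ _ r↓ s≢r 2≤k k≤ℓ sum≡ dom
  with lookup-dominance⇒≽ s r (≤-trans (s≤s z≤n) 2≤k) k≤ℓ dom
... | m , s≽r = subst₂ _<_ (*-identityˡ (prodSucc s)) (*-identityˡ (prodSucc r))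
  (weighted-prodSucc<prodSucc 0 s≽r r↓ r⁺ (trans (+-identityʳ (sum s)) sum≡) (λ _ → s≢r))
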